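{- Let $n\ge1$. The map $\mathrm{Leh}\colon B_n\to\mathrm{SE}^{\mathrm B}_n$ is a bijection, and for every $\sigma\in B_n$, $$\mathrm{Rmil_B}(\mathrm{Leh}\,\sigma)=\mathrm{Rmil_B}\,\sigma\qquad\text{and}\qquad \mathrm{Max}(\mathrm{Leh}\,\sigma)=\mathrm{Lmap_B}\,\sigma.$$
   Context: $B_n$ is the group of bijections $\sigma$ of $\{\pm1,\ldots,\pm n\}$ with $\sigma(-i)=-\sigma(i)$, written as signed permutations $\sigma_1\cdots\sigma_n$ with $\sigma_i=\sigma(i)$ (we write $\bar i=-i$). The Lehmer code of $\sigma\in B_n$ is $\mathrm{Leh}\,\sigma=(a_1,\ldots,a_n)$ with $a_i=\mathrm{sign}(\sigma_i)\cdot|\{j:1\le j\le i,\ |\sigma_j|\le|\sigma_i|\}|$. $\mathrm{SE}^{\mathrm B}_n$ is the set of integer sequences $(a_1,\ldots,a_n)$ with $a_i\in[-i,i]\setminus\{0\}$. For an integer word $\omega=\omega_1\cdots\omega_n$: $\mathrm{Lmap_B}\,\omega=\{i:\omega_i>|\omega_j|\text{ for all }j<i\}$ and $\mathrm{Rmil_B}\,\omega=\{\omega_i: 0<\omega_i<|\omega_j|\text{ for all }j>i\}$; these are applied to $\sigma$ via its word $\sigma_1\cdots\sigma_n$ and to sequences in $\mathrm{SE}^{\mathrm B}_n$ as words. For $a\in\mathrm{SE}^{\mathrm B}_n$, $\mathrm{Max}\,a=\{i:a_i=i\}$. -}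

module Defs where

open import Data.Nat as ℕ using (ℕ; suc)
open import Data.Integer as ℤ using (ℤ; +_; ∣_∣; sign; _◃_)
open import Data.Fin as Fin using (Fin; toℕ)
open import Data.Vec using (Vec; lookup; tabulate)
open import Data.List using (List; length; filter; allFin)
open import Data.Product using (_×_; Σ; ∃)
open import Relation.Nullary using (¬_)
open import Relation.Nullary.Decidable using (_×-dec_)
open import Relation.Binary.PropositionalEquality using (_≡_)

-- Words of length n: position i : Fin n stands for the paper's index toℕ i + 1.

-- σ ∈ B_n, represented by its word σ₁⋯σₙ (σ is determined by its values on 1..n
-- via σ(-i) = -σ(i)); the word must be such that i ↦ |σᵢ| is a permutation of [n].
record IsSignedPerm {n : ℕ} (w : Vec ℤ n) : Set where
  field
    nonzero  : ∀ i → ¬ (lookup w i ≡ + 0)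
    bounded  : ∀ i → ∣ lookup w i ∣ ℕ.≤ n
    absInj   : ∀ i j → ∣ lookup w i ∣ ≡ ∣ lookup w j ∣ → i ≡ j

record IsSE {n : ℕ} (a : Vec ℤ n) : Set where
  field
    nonzero : ∀ i → ¬ (lookup a i ≡ + 0)
    bounded : ∀ i → ∣ lookup a i ∣ ℕ.≤ suc (toℕ i)

lehCount : {n : ℕ} → Vec ℤ n → Fin n → ℕ
lehCount {n} w i =
  length (filter (λ j → (j Fin.≤? i) ×-dec (∣ lookup w j ∣ ℕ.≤? ∣ lookup w i ∣)) (allFin n))

Leh : {n : ℕ} → Vec ℤ n → Vec ℤ n
Leh w = tabulate (λ i → sign (lookup w i) ◃ lehCount w i)

-- Lmap_B ω = { i : ω_i > |ω_j| for all j < i }  (with the convention ω_0 = 0,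
-- i.e. also ω_i > 0)
LmapB : {n : ℕ} → Vec ℤ n → Fin n → Set
LmapB w i = (+ 0 ℤ.< lookup w i) × (∀ j → j Fin.< i → + ∣ lookup w j ∣ ℤ.< lookup w i)

RmilB : {n : ℕ} → Vec ℤ n → ℤ → Set
RmilB w x = ∃ λ i → (lookup w i ≡ x) × (+ 0 ℤ.< x) ×
            (∀ j → i Fin.< j → x ℤ.< + ∣ lookup w j ∣)

Max : {n : ℕ} → Vec ℤ n → Fin n → Set
Max a i = lookup a i ≡ + suc (toℕ i)

-- Write σ = signs ⊙ p with p = |σ| an ordinary permutation. Then |Leh σ| is the classical
-- Lehmer code lehmer p i = #{k ≤ i : p k ≤ p i} and Leh σ carries the signs of σ, so all
-- claims reduce to p. The code of a new entry is its rank among the earlier ones, so by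
-- induction on prefixes the code fixes the relative order of p, hence p; conversely a code
-- is realised by giving each new position its code as value and bumping the earlier values
-- at least as large. For the statistics: lehmer p i = i + 1 iff p i exceeds every earlier
-- value; if p i is below every later value, all values under p i sit at or before i, so
-- lehmer p i = p i while every later code exceeds p i; and increasing codes after i force
-- p i to be a right-to-left minimum.
module Submission where

open import Defs
open import Data.Nat using (ℕ; _≥_)
open import Data.Integer using (ℤ)
open import Data.Fin using (Fin)
open import Data.Vec using (Vec)
open import Data.Product using (_×_; ∃)
open import Function.Bundles using (_⇔_)
open import Relation.Binary.PropositionalEquality using (_≡_)

open import Data.Nat
open import Data.Nat.Properties
open import Data.Nat.Induction using (<-rec)
open import Data.Integer as ℤ using (+_; ∣_∣; sign; _◃_; +<+)
open import Data.Integer.Properties using (abs-◃; sign-◃; ◃-cong; drop‿+<+; ∣i∣≡0⇒i≡0)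
open import Data.Sign as Sign using ()
open import Data.Fin as Fin using (toℕ; fromℕ<)
open import Data.Fin.Properties using (toℕ-fromℕ<; toℕ-injective; toℕ<n)
open import Data.Vec using ([]; _∷_; lookup; tabulate)
open import Data.Vec.Properties using (lookup∘tabulate; tabulate∘lookup; tabulate-cong)
open import Data.List as List using (length; filter)
open import Data.Product using (_,_; proj₁; proj₂; swap)
open import Data.Sum using (inj₁; inj₂)
open import Function using (_∘_; id; case_of_; mk⇔; Equivalence)
open import Level using (0ℓ)
open import Relation.Binary.Definitions using (tri<; tri≈; tri>)
open import Relation.Binary.PropositionalEquality
open import Relation.Nullary using (¬_; yes; no; contradiction)
open import Relation.Nullary.Decidable using (_×-dec_)
open import Relation.Unary using (Pred; Decidable)
open import Relation.Unary.Properties using (∁?; _∩?_)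

count : {P : Pred ℕ 0ℓ} → Decidable P → ℕ → ℕ
count P? zero = 0
count P? (suc m) with P? m
... | yes _ = suc (count P? m)
... | no  _ = count P? m

module _ {P : Pred ℕ 0ℓ} (P? : Decidable P) where

  count-suc-yes : ∀ {m} → P m → count P? (suc m) ≡ suc (count P? m)
  count-suc-yes {m} pm with P? m
  ... | yes _  = refl
  ... | no ¬pm = contradiction pm ¬pm

  count-suc-no : ∀ {m} → ¬ P m → count P? (suc m) ≡ count P? m
  count-suc-no {m} ¬pm with P? m
  ... | yes pm = contradiction pm ¬pm
  ... | no  _  = refl

  count-≤ : ∀ m → count P? m ≤ m
  count-≤ zero = z≤n
  count-≤ (suc m) with P? m
  ... | yes _ = s≤s (count-≤ m)
  ... | no  _ = m≤n⇒m≤1+n (count-≤ m)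

  count-all : ∀ m → (∀ {k} → k < m → P k) → count P? m ≡ m
  count-all zero    _   = refl
  count-all (suc m) all = begin
    count P? (suc m)  ≡⟨ count-suc-yes (all ≤-refl) ⟩
    suc (count P? m)  ≡⟨ cong suc (count-all m (all ∘ m<n⇒m<1+n)) ⟩
    suc m             ∎
    where open ≡-Reasoning

  count-none : ∀ m → (∀ {k} → k < m → ¬ P k) → count P? m ≡ 0
  count-none zero    _    = refl
  count-none (suc m) none = trans (count-suc-no (none ≤-refl)) (count-none m (none ∘ m<n⇒m<1+n))

  count≡⇒all : ∀ m → count P? m ≡ m → ∀ {k} → k < m → P k
  count≡⇒all (suc m) eq {k} k<1+m with P? m
  ... | no _ = contradiction eq (<⇒≢ (s≤s (count-≤ m)))
  ... | yes pm with m<1+n⇒m<n∨m≡n k<1+m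
  ...   | inj₁ k<m  = count≡⇒all m (suc-injective eq) k<m
  ...   | inj₂ refl = pm

  count-pos : ∀ {m k} → k < m → P k → 0 < count P? m
  count-pos {suc m} k<1+m pk with P? m
  ... | yes _  = z<s
  ... | no ¬pm with m<1+n⇒m<n∨m≡n k<1+m
  ...   | inj₁ k<m  = count-pos k<m pk
  ...   | inj₂ refl = contradiction pk ¬pm

  count-≤1 : ∀ m → (∀ {j k} → j < m → k < m → P j → P k → j ≡ k) → count P? m ≤ 1
  count-≤1 zero    _      = z≤n
  count-≤1 (suc m) unique with P? m
  ... | yes pm = s≤s (≤-reflexive (count-none m λ k<m pk →
                   <-irrefl (unique (m<n⇒m<1+n k<m) ≤-refl pk pm) k<m))
  ... | no  _  = count-≤1 m λ j<m k<m → unique (m<n⇒m<1+n j<m) (m<n⇒m<1+n k<m)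

  count-suc-first : ∀ m → count P? (suc m) ≡ count (λ _ → P? 0) 1 + count (P? ∘ suc) m
  count-suc-first zero with P? 0
  ... | yes _ = refl
  ... | no  _ = refl
  count-suc-first (suc m) with P? (suc m)
  ... | yes _ = trans (cong suc (count-suc-first m)) (sym (+-suc _ _))
  ... | no  _ = count-suc-first m

  count+count-∁ : ∀ m → count P? m + count (∁? P?) m ≡ m
  count+count-∁ zero = refl
  count+count-∁ (suc m) with P? m
  ... | yes _ = cong suc (count+count-∁ m)
  ... | no  _ = trans (+-suc _ _) (cong suc (count+count-∁ m))

module _ {P Q : Pred ℕ 0ℓ} (P? : Decidable P) (Q? : Decidable Q) where

  count-mono : ∀ m → (∀ {k} → k < m → P k → Q k) → count P? m ≤ count Q? m
  count-mono zero    _   = z≤n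
  count-mono (suc m) P⊆Q with P? m | Q? m
  ... | yes _  | yes _  = s≤s (count-mono m (P⊆Q ∘ m<n⇒m<1+n))
  ... | yes pm | no ¬qm = contradiction (P⊆Q ≤-refl pm) ¬qm
  ... | no  _  | yes _  = m≤n⇒m≤1+n (count-mono m (P⊆Q ∘ m<n⇒m<1+n))
  ... | no  _  | no  _  = count-mono m (P⊆Q ∘ m<n⇒m<1+n)

  count-split : ∀ m → count P? m ≡ count (P? ∩? Q?) m + count (P? ∩? ∁? Q?) m
  count-split zero = refl
  count-split (suc m) with P? m | Q? m
  ... | yes _ | yes _ = cong suc (count-split m)
  ... | yes _ | no  _ = trans (cong suc (count-split m)) (sym (+-suc _ _))
  ... | no  _ | yes _ = count-split m
  ... | no  _ | no  _ = count-split m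

count-cong : ∀ {P Q : Pred ℕ 0ℓ} (P? : Decidable P) (Q? : Decidable Q) m →
             (∀ {k} → k < m → P k → Q k) → (∀ {k} → k < m → Q k → P k) →
             count P? m ≡ count Q? m
count-cong P? Q? m P⊆Q Q⊆P = ≤-antisym (count-mono P? Q? m P⊆Q) (count-mono Q? P? m Q⊆P)

count-mono-< : ∀ {P Q : Pred ℕ 0ℓ} (P? : Decidable P) (Q? : Decidable Q) m →
               (∀ {k} → k < m → P k → Q k) → ∀ {j} → j < m → Q j → ¬ P j →
               count P? m < count Q? m
count-mono-< P? Q? m P⊆Q j<m qj ¬pj = begin-strict
  count P? m                                  ≡⟨ count-cong P? (Q? ∩? P?) m (λ k<m pk → P⊆Q k<m pk , pk)
                                                                          (λ _ → proj₂) ⟩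
  count (Q? ∩? P?) m                          ≡⟨ +-identityʳ _ ⟨
  count (Q? ∩? P?) m + 0                      <⟨ +-monoʳ-< _ (count-pos (Q? ∩? ∁? P?) j<m (qj , ¬pj)) ⟩
  count (Q? ∩? P?) m + count (Q? ∩? ∁? P?) m  ≡⟨ count-split Q? P? m ⟨
  count Q? m                                  ∎
  where open ≤-Reasoning

prefix : ∀ {P : Pred ℕ 0ℓ} t → Decidable P → Decidable (λ k → k < t × P k)
prefix t P? k = (k <? t) ×-dec P? k

count-prefix : ∀ {P : Pred ℕ 0ℓ} (P? : Decidable P) {t m} → t ≤ m → count (prefix t P?) m ≡ count P? t
count-prefix P? {t} {zero}  z≤n   = refl
count-prefix P? {t} {suc m} t≤1+m with m≤n⇒m<n∨m≡n t≤1+m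
... | inj₂ refl  = count-cong (prefix t P?) P? t (λ _ → proj₂) (λ k<t pk → k<t , pk)
... | inj₁ t<1+m = trans (count-suc-no (prefix t P?) (λ (m<t , _) → <⇒≱ m<t (s≤s⁻¹ t<1+m)))
                         (count-prefix P? (s≤s⁻¹ t<1+m))

count-≤-injection : ∀ {P : Pred ℕ 0ℓ} (P? : Decidable P) (f : ℕ → ℕ) {m} b →
                    (∀ {k} → k < m → P k → f k < b) →
                    (∀ {j k} → j < m → k < m → P j → P k → f j ≡ f k → j ≡ k) →
                    count P? m ≤ b
count-≤-injection P? f {m} zero    f<b _   = ≤-reflexive (count-none P? m λ k<m pk → n≮0 (f<b k<m pk))
count-≤-injection P? f {m} (suc b) f<b inj = begin
  count P? m                                          ≡⟨ count-split P? hits-b m ⟩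
  count (P? ∩? hits-b) m + count (P? ∩? ∁? hits-b) m  ≤⟨ +-mono-≤ at-most-one below-b ⟩
  1 + b                                               ∎
  where
  open ≤-Reasoning
  hits-b : Decidable (λ k → f k ≡ b)
  hits-b k = f k ≟ b
  at-most-one : count (P? ∩? hits-b) m ≤ 1
  at-most-one = count-≤1 (P? ∩? hits-b) m λ j<m k<m (pj , fj≡b) (pk , fk≡b) →
                  inj j<m k<m pj pk (trans fj≡b (sym fk≡b))
  below-b : count (P? ∩? ∁? hits-b) m ≤ b
  below-b = count-≤-injection (P? ∩? ∁? hits-b) f b
              (λ k<m (pk , fk≢b) → ≤∧≢⇒< (s≤s⁻¹ (f<b k<m pk)) fk≢b)
              (λ j<m k<m (pj , _) (pk , _) → inj j<m k<m pj pk)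

atMost? : (f : ℕ → ℕ) (x : ℕ) → Decidable (λ k → f k ≤ x)
atMost? f x k = f k ≤? x

atMost : (ℕ → ℕ) → ℕ → ℕ → ℕ
atMost f x = count (atMost? f x)

atMost-cong : ∀ {f g x y} m → (∀ {k} → k < m → f k ≤ x ⇔ g k ≤ y) → atMost f x m ≡ atMost g y m
atMost-cong {f} {g} {x} {y} m iff =
  count-cong (atMost? f x) (atMost? g y) m (Equivalence.to ∘ iff) (Equivalence.from ∘ iff)

lehmer : (ℕ → ℕ) → ℕ → ℕ
lehmer f i = atMost f (f i) (suc i)

LeftMax : (ℕ → ℕ) → ℕ → Set
LeftMax f i = ∀ {k} → k < i → f k < f i

RightMin : ℕ → (ℕ → ℕ) → ℕ → Set
RightMin n f i = ∀ {j} → i < j → j < n → f i < f j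

lehmer-pos : ∀ f i → 0 < lehmer f i
lehmer-pos f i = count-pos (atMost? f (f i)) ≤-refl ≤-refl

lehmer-≤ : ∀ f i → lehmer f i ≤ suc i
lehmer-≤ f i = count-≤ (atMost? f (f i)) (suc i)

lehmer-unfold : ∀ f i → lehmer f i ≡ suc (atMost f (f i) i)
lehmer-unfold f i = count-suc-yes (atMost? f (f i)) ≤-refl

leftMax⇒lehmer≡ : ∀ f i → LeftMax f i → lehmer f i ≡ suc i
leftMax⇒lehmer≡ f i max = count-all (atMost? f (f i)) (suc i) λ k<1+i →
  case m<1+n⇒m<n∨m≡n k<1+i of λ where
    (inj₁ k<i)  → <⇒≤ (max k<i)
    (inj₂ refl) → ≤-refl

record IsPerm (m : ℕ) (f : ℕ → ℕ) : Set where
  field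
    positive  : ∀ {k} → k < m → 0 < f k
    bounded   : ∀ {k} → k < m → f k ≤ m
    injective : ∀ {j k} → j < m → k < m → f j ≡ f k → j ≡ k

module _ {n : ℕ} {p : ℕ → ℕ} (perm : IsPerm n p) where
  open IsPerm perm

  -- Injectivity bounds both #{k : p k ≤ v} by v and #{k : p k > v} by n ∸ v; the two add up to n.
  atMost-perm : ∀ {v} → v ≤ n → atMost p v n ≡ v
  atMost-perm {v} v≤n = ≤-antisym at-most at-least
    where
    in-range : ∀ {Q} (Q? : Decidable Q) lo hi →
               (∀ {k} → k < n → Q k → lo < p k × p k ≤ hi) → count Q? n ≤ hi ∸ lo
    in-range Q? lo hi range = count-≤-injection Q? (λ k → p k ∸ suc lo) (hi ∸ lo)
      (λ k<n qk → let (lo<pk , pk≤hi) = range k<n qk in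
                  <-≤-trans (∸-monoʳ-< (n<1+n lo) lo<pk) (∸-monoˡ-≤ lo pk≤hi))
      (λ j<n k<n qj qk → injective j<n k<n ∘ ∸-cancelʳ-≡ (proj₁ (range j<n qj)) (proj₁ (range k<n qk)))
    at-most : atMost p v n ≤ v
    at-most = in-range (atMost? p v) 0 v λ k<n pk≤v → positive k<n , pk≤v
    above : count (∁? (atMost? p v)) n ≤ n ∸ v
    above = in-range _ v n λ k<n pk≰v → ≰⇒> pk≰v , bounded k<n
    at-least : v ≤ atMost p v n
    at-least = +-cancelʳ-≤ _ v _ (begin
      v + count (∁? (atMost? p v)) n             ≤⟨ +-monoʳ-≤ v above ⟩
      v + (n ∸ v)                                ≡⟨ m+[n∸m]≡n v≤n ⟩
      n                                          ≡⟨ count+count-∁ (atMost? p v) n ⟨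
      atMost p v n + count (∁? (atMost? p v)) n  ∎)
      where open ≤-Reasoning

  lehmer≡⇒leftMax : ∀ {i} → i < n → lehmer p i ≡ suc i → LeftMax p i
  lehmer≡⇒leftMax {i} i<n lehmer≡ k<i =
    ≤∧≢⇒< (count≡⇒all (atMost? p (p i)) (suc i) lehmer≡ (m<n⇒m<1+n k<i))
          (λ pk≡pi → <⇒≢ k<i (injective (<-trans k<i i<n) i<n pk≡pi))

  rightMin⇒lehmer≡ : ∀ {i} → i < n → RightMin n p i → lehmer p i ≡ p i
  rightMin⇒lehmer≡ {i} i<n min = begin
    lehmer p i                                  ≡⟨ count-prefix (atMost? p (p i)) i<n ⟨
    count (prefix (suc i) (atMost? p (p i))) n  ≡⟨ count-cong _ _ n (λ _ → proj₂)
                                                                (λ k<n pk≤pi → k≤i k<n pk≤pi , pk≤pi) ⟩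
    atMost p (p i) n                            ≡⟨ atMost-perm (bounded i<n) ⟩
    p i                                         ∎
    where
    open ≡-Reasoning
    k≤i : ∀ {k} → k < n → p k ≤ p i → k < suc i
    k≤i k<n pk≤pi = s≤s (≮⇒≥ λ i<k → <⇒≱ (min i<k k<n) pk≤pi)

  rightMin⇒<lehmer : ∀ {i j} → i < n → RightMin n p i → i < j → j < n → p i < lehmer p j
  rightMin⇒<lehmer {i} {j} i<n min i<j j<n = begin-strict
    p i                                               ≡⟨ rightMin⇒lehmer≡ i<n min ⟨
    lehmer p i                                        ≡⟨ count-prefix (atMost? p (p i)) (s≤s (<⇒≤ i<j)) ⟨
    count (prefix (suc i) (atMost? p (p i))) (suc j)  <⟨ fewer ⟩
    lehmer p j                                        ∎
    where
    open ≤-Reasoning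
    fewer : count (prefix (suc i) (atMost? p (p i))) (suc j) < lehmer p j
    fewer = count-mono-< (prefix (suc i) (atMost? p (p i))) (atMost? p (p j)) (suc j)
               (λ _ (_ , pk≤pi) → ≤-trans pk≤pi (<⇒≤ (min i<j j<n)))
               ≤-refl ≤-refl (λ (j<1+i , _) → <⇒≱ i<j (s≤s⁻¹ j<1+i))

  lehmer-increasing⇒rightMin : ∀ {i} → i < n → (∀ {j} → i < j → j < n → lehmer p i < lehmer p j) →
                               RightMin n p i
  lehmer-increasing⇒rightMin {i} i<n increasing {j} = <-rec (λ j → i < j → j < n → p i < p j) step j
    where
    step : ∀ j → (∀ {k} → k < j → i < k → k < n → p i < p k) → i < j → j < n → p i < p j
    step j below i<j j<n with <-cmp (p i) (p j)
    ... | tri< pi<pj _ _ = pi<pj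
    ... | tri≈ _ pi≡pj _ = contradiction (injective i<n j<n pi≡pj) (<⇒≢ i<j)
    ... | tri> _ _ pj<pi = contradiction (increasing i<j j<n) (≤⇒≯ lehmer-j≤lehmer-i)
      where
      before-i : ∀ {k} → k < j → p k ≤ p j → k < i × p k ≤ p i
      before-i {k} k<j pk≤pj with <-cmp k i
      ... | tri< k<i _ _  = k<i , ≤-trans pk≤pj (<⇒≤ pj<pi)
      ... | tri≈ _ refl _ = contradiction pk≤pj (<⇒≱ pj<pi)
      ... | tri> _ _ i<k  = contradiction pk≤pj (<⇒≱ (<-trans pj<pi (below k<j i<k (<-trans k<j j<n))))
      lehmer-j≤lehmer-i : lehmer p j ≤ lehmer p i
      lehmer-j≤lehmer-i = begin
        lehmer p j                                  ≡⟨ lehmer-unfold p j ⟩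
        suc (atMost p (p j) j)                      ≤⟨ s≤s (count-mono _ (prefix i (atMost? p (p i))) j before-i) ⟩
        suc (count (prefix i (atMost? p (p i))) j)  ≡⟨ cong suc (count-prefix (atMost? p (p i)) (<⇒≤ i<j)) ⟩
        suc (atMost p (p i) i)                      ≡⟨ lehmer-unfold p i ⟨
        lehmer p i                                  ∎
        where open ≤-Reasoning

  <⇔atMost<lehmer : ∀ {i j} → i < n → j < i → p j < p i ⇔ atMost p (p j) i < lehmer p i
  <⇔atMost<lehmer {i} {j} i<n j<i = mk⇔ to from
    where
    to : p j < p i → atMost p (p j) i < lehmer p i
    to pj<pi = begin-strict
      atMost p (p j) i        ≤⟨ count-mono (atMost? p (p j)) _ i
                                   (λ _ pk≤pj → ≤-trans pk≤pj (<⇒≤ pj<pi)) ⟩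
      atMost p (p i) i        <⟨ n<1+n _ ⟩
      suc (atMost p (p i) i)  ≡⟨ lehmer-unfold p i ⟨
      lehmer p i              ∎
      where open ≤-Reasoning
    from : atMost p (p j) i < lehmer p i → p j < p i
    from lt with <-cmp (p j) (p i)
    ... | tri< pj<pi _ _ = pj<pi
    ... | tri≈ _ pj≡pi _ = contradiction (injective (<-trans j<i i<n) i<n pj≡pi) (<⇒≢ j<i)
    ... | tri> _ _ pi<pj = contradiction lt (≤⇒≯ (begin
      lehmer p i              ≡⟨ lehmer-unfold p i ⟩
      suc (atMost p (p i) i)  ≤⟨ count-mono-< (atMost? p (p i)) _ i (λ _ pk≤pi → ≤-trans pk≤pi (<⇒≤ pi<pj))
                                                j<i ≤-refl (<⇒≱ pi<pj) ⟩
      atMost p (p j) i        ∎))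
      where open ≤-Reasoning

OrderRespecting : ℕ → (ℕ → ℕ) → (ℕ → ℕ) → Set
OrderRespecting m p q = ∀ {j k} → j < m → k < m → p j < p k → q j < q k

OrderIsomorphic : ℕ → (ℕ → ℕ) → (ℕ → ℕ) → Set
OrderIsomorphic m p q = OrderRespecting m p q × OrderRespecting m q p

orderIsomorphic⇒atMost≡ : ∀ {m p q j} → OrderIsomorphic m p q → j < m →
                          atMost p (p j) m ≡ atMost q (q j) m
orderIsomorphic⇒atMost≡ {m} (p⇒q , q⇒p) j<m = atMost-cong m λ k<m → mk⇔
  (λ pk≤pj → ≮⇒≥ λ qj<qk → <⇒≱ (q⇒p j<m k<m qj<qk) pk≤pj)
  (λ qk≤qj → ≮⇒≥ λ pj<pk → <⇒≱ (p⇒q j<m k<m pj<pk) qk≤qj)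

lehmer≡⇒respects-last : ∀ {n p q i j} → IsPerm n p → IsPerm n q → i < n → lehmer p i ≡ lehmer q i →
                        OrderIsomorphic i p q → j < i → p j < p i → q j < q i
lehmer≡⇒respects-last perm-p perm-q i<n lehmer≡ iso j<i =
  Equivalence.from (<⇔atMost<lehmer perm-q i<n j<i)
  ∘ subst₂ _<_ (orderIsomorphic⇒atMost≡ iso j<i) lehmer≡
  ∘ Equivalence.to (<⇔atMost<lehmer perm-p i<n j<i)

lehmer≡⇒orderIsomorphic : ∀ {n p q} → IsPerm n p → IsPerm n q →
                          (∀ {i} → i < n → lehmer p i ≡ lehmer q i) →
                          ∀ {m} → m ≤ n → OrderIsomorphic m p q
lehmer≡⇒orderIsomorphic perm-p perm-q lehmer≡ {zero}  _   = (λ ()) , (λ ())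
lehmer≡⇒orderIsomorphic {n} {p} {q} perm-p perm-q lehmer≡ {suc i} i<n =
  extend perm-p perm-q (lehmer≡ i<n) iso , extend perm-q perm-p (sym (lehmer≡ i<n)) (swap iso)
  where
  iso : OrderIsomorphic i p q
  iso = lehmer≡⇒orderIsomorphic perm-p perm-q lehmer≡ (<⇒≤ i<n)
  extend : ∀ {p q} → IsPerm n p → IsPerm n q → lehmer p i ≡ lehmer q i → OrderIsomorphic i p q →
           OrderRespecting (suc i) p q
  extend {p} {q} perm-p perm-q lehmer-i≡ iso {j} {k} j<1+i k<1+i
    with m<1+n⇒m<n∨m≡n j<1+i | m<1+n⇒m<n∨m≡n k<1+i
  ... | inj₁ j<i  | inj₁ k<i  = proj₁ iso j<i k<i
  ... | inj₁ j<i  | inj₂ refl = lehmer≡⇒respects-last perm-p perm-q i<n lehmer-i≡ iso j<i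
  ... | inj₂ refl | inj₂ refl = λ pi<pi → contradiction pi<pi (<-irrefl refl)
  ... | inj₂ refl | inj₁ k<i  = λ pi<pk → case <-cmp (q i) (q k) of λ where
    (tri< qi<qk _ _) → qi<qk
    (tri≈ _ qi≡qk _) → contradiction (IsPerm.injective perm-q i<n (<-trans k<i i<n) qi≡qk) (>⇒≢ k<i)
    (tri> _ _ qk<qi) → contradiction pi<pk
                         (<-asym (lehmer≡⇒respects-last perm-q perm-p i<n (sym lehmer-i≡) (swap iso) k<i qk<qi))

lehmer-injective : ∀ {n p q} → IsPerm n p → IsPerm n q → (∀ {i} → i < n → lehmer p i ≡ lehmer q i) →
                   ∀ {i} → i < n → p i ≡ q i
lehmer-injective {n} {p} {q} perm-p perm-q lehmer≡ {i} i<n = begin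
  p i               ≡⟨ atMost-perm perm-p (IsPerm.bounded perm-p i<n) ⟨
  atMost p (p i) n  ≡⟨ orderIsomorphic⇒atMost≡ iso i<n ⟩
  atMost q (q i) n  ≡⟨ atMost-perm perm-q (IsPerm.bounded perm-q i<n) ⟩
  q i               ∎
  where
  open ≡-Reasoning
  iso : OrderIsomorphic n p q
  iso = lehmer≡⇒orderIsomorphic perm-p perm-q lehmer≡ ≤-refl

bump : ℕ → ℕ → ℕ
bump v x with v ≤? x
... | yes _ = suc x
... | no  _ = x

bump-mono-≤ : ∀ v {x y} → x ≤ y → bump v x ≤ bump v y
bump-mono-≤ v {x} {y} x≤y with v ≤? x | v ≤? y
... | yes _   | yes _   = s≤s x≤y
... | yes v≤x | no  v≰y = contradiction (≤-trans v≤x x≤y) v≰y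
... | no  _   | yes _   = m≤n⇒m≤1+n x≤y
... | no  _   | no  _   = x≤y

bump-cancel-≤ : ∀ v {x y} → bump v x ≤ bump v y → x ≤ y
bump-cancel-≤ v {x} {y} le with v ≤? x | v ≤? y
... | yes _   | yes _   = s≤s⁻¹ le
... | yes v≤x | no  v≰y = contradiction (≤-trans v≤x (≤-trans (n≤1+n x) le)) v≰y
... | no  v≰x | yes v≤y = ≤-trans (<⇒≤ (≰⇒> v≰x)) v≤y
... | no  _   | no  _   = le

bump-injective : ∀ v {x y} → bump v x ≡ bump v y → x ≡ y
bump-injective v eq = ≤-antisym (bump-cancel-≤ v (≤-reflexive eq)) (bump-cancel-≤ v (≤-reflexive (sym eq)))

bump≢ : ∀ v x → bump v x ≢ v
bump≢ v x with v ≤? x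
... | yes v≤x = >⇒≢ (s≤s v≤x)
... | no  v≰x = λ x≡v → v≰x (≤-reflexive (sym x≡v))

bump-≥ : ∀ v x → x ≤ bump v x
bump-≥ v x with v ≤? x
... | yes _ = n≤1+n x
... | no  _ = ≤-refl

bump-≤ : ∀ v x → bump v x ≤ suc x
bump-≤ v x with v ≤? x
... | yes _ = ≤-refl
... | no  _ = n≤1+n x

IsLehmerCode : ℕ → (ℕ → ℕ) → Set
IsLehmerCode m c = ∀ {k} → k < m → 0 < c k × c k ≤ suc k

build : (ℕ → ℕ) → ℕ → ℕ → ℕ
build c zero    j = 0
build c (suc m) j with j ≟ m
... | yes _ = c m
... | no  _ = bump (c m) (build c m j)

module _ (c : ℕ → ℕ) where

  build-last : ∀ m → build c (suc m) m ≡ c m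
  build-last m with m ≟ m
  ... | yes _   = refl
  ... | no  m≢m = contradiction refl m≢m

  build-earlier : ∀ {m j} → j < m → build c (suc m) j ≡ bump (c m) (build c m j)
  build-earlier {m} {j} j<m with j ≟ m
  ... | yes j≡m = contradiction j≡m (<⇒≢ j<m)
  ... | no  _   = refl

  build-isPerm : ∀ m → IsLehmerCode m c → IsPerm m (build c m)
  build-isPerm zero    _    = record { positive = λ () ; bounded = λ () ; injective = λ () }
  build-isPerm (suc m) code = record { positive = positive ; bounded = bounded ; injective = injective }
    where
    module Prev = IsPerm (build-isPerm m (code ∘ m<n⇒m<1+n))
    positive : ∀ {k} → k < suc m → 0 < build c (suc m) k
    positive k<1+m with m<1+n⇒m<n∨m≡n k<1+m
    ... | inj₁ k<m  = subst (0 <_) (sym (build-earlier k<m)) (<-≤-trans (Prev.positive k<m) (bump-≥ (c m) _))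
    ... | inj₂ refl = subst (0 <_) (sym (build-last m)) (proj₁ (code ≤-refl))
    bounded : ∀ {k} → k < suc m → build c (suc m) k ≤ suc m
    bounded k<1+m with m<1+n⇒m<n∨m≡n k<1+m
    ... | inj₁ k<m  = subst (_≤ suc m) (sym (build-earlier k<m))
                            (≤-trans (bump-≤ (c m) _) (s≤s (Prev.bounded k<m)))
    ... | inj₂ refl = subst (_≤ suc m) (sym (build-last m)) (proj₂ (code ≤-refl))
    injective : ∀ {j k} → j < suc m → k < suc m → build c (suc m) j ≡ build c (suc m) k → j ≡ k
    injective j<1+m k<1+m eq with m<1+n⇒m<n∨m≡n j<1+m | m<1+n⇒m<n∨m≡n k<1+m
    ... | inj₁ j<m  | inj₁ k<m  =
      Prev.injective j<m k<m (bump-injective (c m) (trans (sym (build-earlier j<m)) (trans eq (build-earlier k<m))))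
    ... | inj₁ j<m  | inj₂ refl =
      contradiction (trans (sym (build-earlier j<m)) (trans eq (build-last m))) (bump≢ (c m) _)
    ... | inj₂ refl | inj₁ k<m  =
      contradiction (trans (sym (build-earlier k<m)) (trans (sym eq) (build-last m))) (bump≢ (c m) _)
    ... | inj₂ refl | inj₂ refl = refl

  build-≤-stable : ∀ {t m j k} → t ≤ m → j < t → k < t →
                   build c m j ≤ build c m k ⇔ build c t j ≤ build c t k
  build-≤-stable {t} {zero}  t≤0   j<t _   = contradiction (<-≤-trans j<t t≤0) λ ()
  build-≤-stable {t} {suc m} t≤1+m j<t k<t with m≤n⇒m<n∨m≡n t≤1+m
  ... | inj₂ refl  = mk⇔ id id
  ... | inj₁ t<1+m = mk⇔
      (Equivalence.to prev ∘ bump-cancel-≤ (c m) ∘ subst₂ _≤_ (build-earlier j<m) (build-earlier k<m))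
      (subst₂ _≤_ (sym (build-earlier j<m)) (sym (build-earlier k<m)) ∘ bump-mono-≤ (c m) ∘ Equivalence.from prev)
    where
    t≤m  = s≤s⁻¹ t<1+m
    prev = build-≤-stable t≤m j<t k<t
    j<m  = <-≤-trans j<t t≤m
    k<m  = <-≤-trans k<t t≤m

  lehmer-build : ∀ {n} → IsLehmerCode n c → ∀ {i} → i < n → lehmer (build c n) i ≡ c i
  lehmer-build {n} code {i} i<n = begin
    lehmer (build c n) i                    ≡⟨ atMost-cong (suc i) (λ k<1+i → build-≤-stable i<n k<1+i ≤-refl) ⟩
    lehmer (build c (suc i)) i              ≡⟨ cong (λ x → atMost (build c (suc i)) x (suc i)) (build-last i) ⟩
    atMost (build c (suc i)) (c i) (suc i)  ≡⟨ atMost-perm prefix-perm (proj₂ (code i<n)) ⟩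
    c i                                     ∎
    where
    open ≡-Reasoning
    prefix-perm : IsPerm (suc i) (build c (suc i))
    prefix-perm = build-isPerm (suc i) (code ∘ λ k<1+i → <-≤-trans k<1+i i<n)

≢0⇒∣∣>0 : ∀ {z} → z ≢ + 0 → 0 < ∣ z ∣
≢0⇒∣∣>0 z≢0 = n≢0⇒n>0 (z≢0 ∘ ∣i∣≡0⇒i≡0)

∣∣>0⇒≢0 : ∀ {z} → 0 < ∣ z ∣ → z ≢ + 0
∣∣>0⇒≢0 ∣z∣>0 refl = <-irrefl refl ∣z∣>0

sign-◃-pos : ∀ s {m} → 0 < m → sign (s ◃ m) ≡ s
sign-◃-pos s m>0 = sign-◃ s _ {{>-nonZero m>0}}

positive⇒sign+ : ∀ {z} → + 0 ℤ.< z → sign z ≡ Sign.+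
positive⇒sign+ (+<+ _) = refl

sign+⇒positive : ∀ {z} → z ≢ + 0 → sign z ≡ Sign.+ → + 0 ℤ.< z
sign+⇒positive {+ zero}  z≢0 _ = contradiction refl z≢0
sign+⇒positive {+ suc _} _   _ = +<+ z<s

positive⇒≡+∣∣ : ∀ {z} → + 0 ℤ.< z → z ≡ + ∣ z ∣
positive⇒≡+∣∣ (+<+ _) = refl

∀Fin⇒∀< : ∀ {n} (P : ℕ → Set) → (∀ (j : Fin n) → P (toℕ j)) → ∀ {k} → k < n → P k
∀Fin⇒∀< P all k<n = subst P (toℕ-fromℕ< k<n) (all (fromℕ< k<n))

vec-ext : ∀ {n} {u v : Vec ℤ n} → (∀ i → lookup u i ≡ lookup v i) → u ≡ v
vec-ext {u = u} {v} pointwise =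
  trans (sym (tabulate∘lookup u)) (trans (tabulate-cong pointwise) (tabulate∘lookup v))

-- Junk value 0 past the end of the word.
absAt : ∀ {n} → Vec ℤ n → ℕ → ℕ
absAt []      _       = 0
absAt (x ∷ w) zero    = ∣ x ∣
absAt (x ∷ w) (suc k) = absAt w k

absAt-lookup : ∀ {n} (w : Vec ℤ n) i → ∣ lookup w i ∣ ≡ absAt w (toℕ i)
absAt-lookup (x ∷ w) Fin.zero    = refl
absAt-lookup (x ∷ w) (Fin.suc i) = absAt-lookup w i

absAt-fromℕ< : ∀ {n} (w : Vec ℤ n) {k} (k<n : k < n) → absAt w k ≡ ∣ lookup w (fromℕ< k<n) ∣
absAt-fromℕ< w k<n = trans (cong (absAt w) (sym (toℕ-fromℕ< k<n))) (sym (absAt-lookup w (fromℕ< k<n)))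

isSignedPerm⇒isPerm : ∀ {n} {w : Vec ℤ n} → IsSignedPerm w → IsPerm n (absAt w)
isSignedPerm⇒isPerm {n} {w} signed = record
  { positive  = λ k<n → subst (0 <_) (sym (absAt-fromℕ< w k<n)) (≢0⇒∣∣>0 (nonzero _))
  ; bounded   = λ k<n → subst (_≤ n) (sym (absAt-fromℕ< w k<n)) (bounded _)
  ; injective = λ {j} {k} j<n k<n eq → begin
      j                 ≡⟨ toℕ-fromℕ< j<n ⟨
      toℕ (fromℕ< j<n)  ≡⟨ cong toℕ (absInj _ _ (trans (sym (absAt-fromℕ< w j<n))
                                                     (trans eq (absAt-fromℕ< w k<n)))) ⟩
      toℕ (fromℕ< k<n)  ≡⟨ toℕ-fromℕ< k<n ⟩
      k                 ∎
  }
  where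
  open IsSignedPerm signed
  open ≡-Reasoning

isPerm⇒isSignedPerm : ∀ {n f} {w : Vec ℤ n} → (∀ j → ∣ lookup w j ∣ ≡ f (toℕ j)) → IsPerm n f →
                      IsSignedPerm w
isPerm⇒isSignedPerm abs≡ perm = record
  { nonzero = λ i → ∣∣>0⇒≢0 (subst (0 <_) (sym (abs≡ i)) (positive (toℕ<n i)))
  ; bounded = λ i → subst (_≤ _) (sym (abs≡ i)) (bounded (toℕ<n i))
  ; absInj  = λ i j eq →
      toℕ-injective (injective (toℕ<n i) (toℕ<n j) (trans (sym (abs≡ i)) (trans eq (abs≡ j))))
  }
  where open IsPerm perm

length-filter-tabulate : ∀ {A : Set} n (f : Fin n → A) {Q : Pred A 0ℓ} (Q? : Decidable Q)
                         {R : Pred ℕ 0ℓ} (R? : Decidable R) → (∀ j → Q (f j) ⇔ R (toℕ j)) →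
                         length (filter Q? (List.tabulate f)) ≡ count R? n
length-filter-tabulate zero    f Q? R? Q⇔R = refl
length-filter-tabulate (suc n) f Q? R? Q⇔R = trans (head (R? 0)) (sym (count-suc-first R? n))
  where
  tail : length (filter Q? (List.tabulate (f ∘ Fin.suc))) ≡ count (R? ∘ suc) n
  tail = length-filter-tabulate n (f ∘ Fin.suc) Q? (R? ∘ suc) (Q⇔R ∘ Fin.suc)
  head : ∀ r0? → length (filter Q? (List.tabulate f)) ≡ count (λ _ → r0?) 1 + count (R? ∘ suc) n
  head r0? with Q? (f Fin.zero) | r0?
  ... | yes _  | yes _  = cong suc tail
  ... | yes q  | no ¬r  = contradiction (Equivalence.to (Q⇔R Fin.zero) q) ¬r
  ... | no ¬q  | yes r  = contradiction (Equivalence.from (Q⇔R Fin.zero) r) ¬q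
  ... | no _   | no _   = tail

lehCount≡lehmer : ∀ {n} (w : Vec ℤ n) g → (∀ j → ∣ lookup w j ∣ ≡ g (toℕ j)) →
                  ∀ i → lehCount w i ≡ lehmer g (toℕ i)
lehCount≡lehmer {n} w g abs≡ i = begin
  lehCount w i                                ≡⟨ length-filter-tabulate n id _ (prefix (suc t) (atMost? g (g t)))
                                                                          same ⟩
  count (prefix (suc t) (atMost? g (g t))) n  ≡⟨ count-prefix (atMost? g (g t)) (toℕ<n i) ⟩
  lehmer g t                                  ∎
  where
  open ≡-Reasoning
  t = toℕ i
  same : ∀ j → (j Fin.≤ i × ∣ lookup w j ∣ ≤ ∣ lookup w i ∣) ⇔ (toℕ j < suc t × g (toℕ j) ≤ g t)
  same j = mk⇔ (λ (j≤i , le) → s≤s j≤i , subst₂ _≤_ (abs≡ j) (abs≡ i) le)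
               (λ (j<1+i , le) → s≤s⁻¹ j<1+i , subst₂ _≤_ (sym (abs≡ j)) (sym (abs≡ i)) le)

module _ {n} (w : Vec ℤ n) where

  Leh-abs : ∀ g → (∀ j → ∣ lookup w j ∣ ≡ g (toℕ j)) →
            ∀ i → ∣ lookup (Leh w) i ∣ ≡ lehmer g (toℕ i)
  Leh-abs g abs≡ i = begin
    ∣ lookup (Leh w) i ∣                  ≡⟨ cong ∣_∣ (lookup∘tabulate _ i) ⟩
    ∣ sign (lookup w i) ◃ lehCount w i ∣  ≡⟨ abs-◃ _ _ ⟩
    lehCount w i                          ≡⟨ lehCount≡lehmer w g abs≡ i ⟩
    lehmer g (toℕ i)                      ∎
    where open ≡-Reasoning

  Leh-absAt : ∀ i → ∣ lookup (Leh w) i ∣ ≡ lehmer (absAt w) (toℕ i)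
  Leh-absAt = Leh-abs (absAt w) (absAt-lookup w)

  Leh-sign : ∀ i → sign (lookup (Leh w) i) ≡ sign (lookup w i)
  Leh-sign i = trans (cong sign (lookup∘tabulate _ i)) (sign-◃-pos _ lehCount>0)
    where
    lehCount>0 : 0 < lehCount w i
    lehCount>0 = subst (0 <_) (sym (lehCount≡lehmer w (absAt w) (absAt-lookup w) i)) (lehmer-pos (absAt w) (toℕ i))

  Leh-isSE : IsSE (Leh w)
  Leh-isSE = record
    { nonzero = λ i → ∣∣>0⇒≢0 (subst (0 <_) (sym (Leh-absAt i)) (lehmer-pos (absAt w) (toℕ i)))
    ; bounded = λ i → subst (_≤ suc (toℕ i)) (sym (Leh-absAt i)) (lehmer-≤ (absAt w) (toℕ i))
    }

Leh-injective : ∀ {n} {σ τ : Vec ℤ n} → IsSignedPerm σ → IsSignedPerm τ → Leh σ ≡ Leh τ → σ ≡ τ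
Leh-injective {n} {σ} {τ} signed-σ signed-τ Leh≡ = vec-ext λ i → ◃-cong (sign≡ i) (abs≡ i)
  where
  lehmer≡ : ∀ {k} → k < n → lehmer (absAt σ) k ≡ lehmer (absAt τ) k
  lehmer≡ = ∀Fin⇒∀< (λ k → lehmer (absAt σ) k ≡ lehmer (absAt τ) k) λ j →
    trans (sym (Leh-absAt σ j)) (trans (cong (λ a → ∣ lookup a j ∣) Leh≡) (Leh-absAt τ j))
  sign≡ : ∀ i → sign (lookup σ i) ≡ sign (lookup τ i)
  sign≡ i = trans (sym (Leh-sign σ i)) (trans (cong (λ a → sign (lookup a i)) Leh≡) (Leh-sign τ i))
  abs≡ : ∀ i → ∣ lookup σ i ∣ ≡ ∣ lookup τ i ∣
  abs≡ i = begin
    ∣ lookup σ i ∣   ≡⟨ absAt-lookup σ i ⟩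
    absAt σ (toℕ i)  ≡⟨ lehmer-injective (isSignedPerm⇒isPerm signed-σ) (isSignedPerm⇒isPerm signed-τ)
                                          lehmer≡ (toℕ<n i) ⟩
    absAt τ (toℕ i)  ≡⟨ absAt-lookup τ i ⟨
    ∣ lookup τ i ∣   ∎
    where open ≡-Reasoning

Leh⁻¹ : ∀ {n} → Vec ℤ n → Vec ℤ n
Leh⁻¹ {n} a = tabulate λ j → sign (lookup a j) ◃ build (absAt a) n (toℕ j)

module _ {n} {a : Vec ℤ n} (se : IsSE a) where
  open IsSE se

  private
    code : IsLehmerCode n (absAt a)
    code = ∀Fin⇒∀< (λ k → 0 < absAt a k × absAt a k ≤ suc k) λ j →
      subst (λ v → 0 < v × v ≤ suc (toℕ j)) (absAt-lookup a j) (≢0⇒∣∣>0 (nonzero j) , bounded j)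

    perm : IsPerm n (build (absAt a) n)
    perm = build-isPerm (absAt a) n code

    Leh⁻¹-abs : ∀ j → ∣ lookup (Leh⁻¹ a) j ∣ ≡ build (absAt a) n (toℕ j)
    Leh⁻¹-abs j = trans (cong ∣_∣ (lookup∘tabulate _ j)) (abs-◃ _ _)

  Leh⁻¹-isSignedPerm : IsSignedPerm (Leh⁻¹ a)
  Leh⁻¹-isSignedPerm = isPerm⇒isSignedPerm Leh⁻¹-abs perm

  Leh∘Leh⁻¹ : Leh (Leh⁻¹ a) ≡ a
  Leh∘Leh⁻¹ = vec-ext λ i → ◃-cong (sign≡ i) (abs≡ i)
    where
    sign≡ : ∀ i → sign (lookup (Leh (Leh⁻¹ a)) i) ≡ sign (lookup a i)
    sign≡ i = trans (Leh-sign (Leh⁻¹ a) i)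
                    (trans (cong sign (lookup∘tabulate _ i)) (sign-◃-pos _ (IsPerm.positive perm (toℕ<n i))))
    abs≡ : ∀ i → ∣ lookup (Leh (Leh⁻¹ a)) i ∣ ≡ ∣ lookup a i ∣
    abs≡ i = begin
      ∣ lookup (Leh (Leh⁻¹ a)) i ∣        ≡⟨ Leh-abs (Leh⁻¹ a) (build (absAt a) n) Leh⁻¹-abs i ⟩
      lehmer (build (absAt a) n) (toℕ i)  ≡⟨ lehmer-build (absAt a) code (toℕ<n i) ⟩
      absAt a (toℕ i)                     ≡⟨ absAt-lookup a i ⟨
      ∣ lookup a i ∣                      ∎
      where open ≡-Reasoning

module _ {n} {σ : Vec ℤ n} (signed : IsSignedPerm σ) where

  private
    p = absAt σ
    perm = isSignedPerm⇒isPerm signed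

    positive-entry : ∀ {i} → + 0 ℤ.< lookup σ i → lookup σ i ≡ + p (toℕ i)
    positive-entry {i} σᵢ>0 = trans (positive⇒≡+∣∣ σᵢ>0) (cong +_ (absAt-lookup σ i))

    Leh-positive : ∀ {i} → + 0 ℤ.< lookup (Leh σ) i → + 0 ℤ.< lookup σ i
    Leh-positive {i} Lehᵢ>0 =
      sign+⇒positive (IsSignedPerm.nonzero signed i) (trans (sym (Leh-sign σ i)) (positive⇒sign+ Lehᵢ>0))

    Leh-at-positive : ∀ {i} → + 0 ℤ.< lookup σ i → lookup (Leh σ) i ≡ + lehmer p (toℕ i)
    Leh-at-positive {i} σᵢ>0 = ◃-cong (trans (Leh-sign σ i) (positive⇒sign+ σᵢ>0)) (Leh-absAt σ i)

  Max-Leh⇔LmapB : ∀ i → Max (Leh σ) i ⇔ LmapB σ i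
  Max-Leh⇔LmapB i = mk⇔ to from
    where
    t = toℕ i
    to : Max (Leh σ) i → LmapB σ i
    to Lehᵢ≡ = σᵢ>0 , λ j j<i → subst (+ ∣ lookup σ j ∣ ℤ.<_) (sym (positive-entry σᵢ>0))
                                   (+<+ (subst (_< p t) (sym (absAt-lookup σ j)) (leftMax j<i)))
      where
      σᵢ>0 = Leh-positive (subst (+ 0 ℤ.<_) (sym Lehᵢ≡) (+<+ z<s))
      leftMax : LeftMax p t
      leftMax = lehmer≡⇒leftMax perm (toℕ<n i) (trans (sym (Leh-absAt σ i)) (cong ∣_∣ Lehᵢ≡))
    from : LmapB σ i → Max (Leh σ) i
    from (σᵢ>0 , above) = trans (Leh-at-positive σᵢ>0) (cong +_ (leftMax⇒lehmer≡ p t leftMax))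
      where
      leftMax : LeftMax p t
      leftMax {k} k<t = ∀Fin⇒∀< (λ k → k < t → p k < p t)
        (λ j j<i → subst (_< p t) (absAt-lookup σ j)
                     (drop‿+<+ (subst (+ ∣ lookup σ j ∣ ℤ.<_) (positive-entry σᵢ>0) (above j j<i))))
        (<-trans k<t (toℕ<n i)) k<t

  RmilB-Leh⇔RmilB : ∀ x → RmilB (Leh σ) x ⇔ RmilB σ x
  RmilB-Leh⇔RmilB x = mk⇔ to from
    where
    to : RmilB (Leh σ) x → RmilB σ x
    to (i , Lehᵢ≡x , x>0 , below) = i , trans (positive-entry σᵢ>0) (sym x≡pᵢ) , x>0 , above
      where
      t = toℕ i
      σᵢ>0 = Leh-positive (subst (+ 0 ℤ.<_) (sym Lehᵢ≡x) x>0)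
      x≡lehmer : x ≡ + lehmer p t
      x≡lehmer = trans (sym Lehᵢ≡x) (Leh-at-positive σᵢ>0)
      increasing : ∀ {j} → t < j → j < n → lehmer p t < lehmer p j
      increasing {j} t<j j<n = ∀Fin⇒∀< (λ j → t < j → lehmer p t < lehmer p j)
        (λ J t<J → drop‿+<+ (subst₂ ℤ._<_ x≡lehmer (cong +_ (Leh-absAt σ J)) (below J t<J))) j<n t<j
      min : RightMin n p t
      min = lehmer-increasing⇒rightMin perm (toℕ<n i) increasing
      x≡pᵢ : x ≡ + p t
      x≡pᵢ = trans x≡lehmer (cong +_ (rightMin⇒lehmer≡ perm (toℕ<n i) min))
      above : ∀ J → i Fin.< J → x ℤ.< + ∣ lookup σ J ∣
      above J t<J = subst₂ ℤ._<_ (sym x≡pᵢ) (cong +_ (sym (absAt-lookup σ J))) (+<+ (min t<J (toℕ<n J)))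
    from : RmilB σ x → RmilB (Leh σ) x
    from (i , σᵢ≡x , x>0 , below) = i , Lehᵢ≡x , x>0 , above
      where
      t = toℕ i
      σᵢ>0 = subst (+ 0 ℤ.<_) (sym σᵢ≡x) x>0
      x≡pᵢ : x ≡ + p t
      x≡pᵢ = trans (sym σᵢ≡x) (positive-entry σᵢ>0)
      min : RightMin n p t
      min {j} t<j j<n = ∀Fin⇒∀< (λ j → t < j → p t < p j)
        (λ J t<J → drop‿+<+ (subst₂ ℤ._<_ x≡pᵢ (cong +_ (absAt-lookup σ J)) (below J t<J))) j<n t<j
      Lehᵢ≡x : lookup (Leh σ) i ≡ x
      Lehᵢ≡x = begin
        lookup (Leh σ) i  ≡⟨ Leh-at-positive σᵢ>0 ⟩
        + lehmer p t      ≡⟨ cong +_ (rightMin⇒lehmer≡ perm (toℕ<n i) min) ⟩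
        + p t             ≡⟨ x≡pᵢ ⟨
        x                 ∎
        where open ≡-Reasoning
      above : ∀ J → i Fin.< J → x ℤ.< + ∣ lookup (Leh σ) J ∣
      above J t<J = subst₂ ℤ._<_ (sym x≡pᵢ) (cong +_ (sym (Leh-absAt σ J)))
                      (+<+ (rightMin⇒<lehmer perm (toℕ<n i) min t<J (toℕ<n J)))

proposition3p2 : (n : ℕ) → n ≥ 1 →
    ((σ : Vec ℤ n) → IsSignedPerm σ → IsSE (Leh σ))
    × ((σ τ : Vec ℤ n) → IsSignedPerm σ → IsSignedPerm τ → Leh σ ≡ Leh τ → σ ≡ τ)
    × ((a : Vec ℤ n) → IsSE a → ∃ λ σ → IsSignedPerm σ × Leh σ ≡ a)
    × ((σ : Vec ℤ n) → IsSignedPerm σ →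
        ((x : ℤ) → RmilB (Leh σ) x ⇔ RmilB σ x)
        × ((i : Fin n) → Max (Leh σ) i ⇔ LmapB σ i))
proposition3p2 n _ =
    (λ σ _ → Leh-isSE σ)
  , (λ _ _ → Leh-injective)
  , (λ a se → Leh⁻¹ a , Leh⁻¹-isSignedPerm se , Leh∘Leh⁻¹ se)
  , (λ _ signed → RmilB-Leh⇔RmilB signed , Max-Leh⇔LmapB signed)
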